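{- Let $K$ be a finite simplicial complex, let $\overrightarrow{W}$ be a Morse sequence on $K$, and let $\Upsilon$ be the Morse reference of $\overrightarrow{W}$ and $\Upsilon^*$ its Morse co-reference. Let $\sigma\in K^{(p)}$ and $\tau\in K^{(p+1)}$ be both critical for $\overrightarrow{W}$. Then $\sigma\in\Upsilon(\partial(\tau))$ if and only if $\tau\in\Upsilon^*(\delta(\sigma))$.
   Context: A finite simplicial complex $K$ is a finite family of non-empty finite sets such that $\sigma\in K$ whenever $\emptyset\neq\sigma\subseteq\tau$ for some $\tau\in K$; $K^{(p)}$ is the set of $p$-simplexes (sets of $p+1$ elements), and a facet is an inclusion-maximal simplex. For $p\ge -1$, $K[p]$ is the set of all subsets of $K^{(p)}$ (with $K^{(-1)}=\emptyset$), a $\mathbb{Z}_2$-vector space under symmetric difference, the empty chain being $0$. For $\sigma\in K^{(p)}$, $\partial(\sigma)=\{\tau\in K^{(p-1)}:\tau\subset\sigma\}$ and $\delta(\sigma)=\{\tau\in K^{(p+1)}:\sigma\subset\tau\}$. A pair $(\sigma,\tau)$ with $\sigma\in K^{(p)},\tau\in K^{(p+1)}$ is free for $K$ if $\tau$ is the only simplex of $K$ strictly containing $\sigma$; then $K$ is an elementary expansion of $K\setminus\{\sigma,\tau\}$. If $\sigma$ is a facet of $K$, $K$ is an elementary filling of $K\setminus\{\sigma\}$. A Morse sequence on $K$ is a sequence $\langle\emptyset=K_0,\dots,K_k=K\rangle$ where each $K_i$ is an elementary expansion or elementary filling of $K_{i-1}$; a simplex added by a filling is critical, and a free pair $(\sigma,\tau)$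 added by an expansion is a regular pair. $\ddot{W}[p]$ denotes the set of subsets of the set of critical $p$-simplexes. A Morse frame is a map $\Upsilon$ sending each $\sigma\in K^{(p)}$ to $\Upsilon(\sigma)\in\ddot{W}[p]$, extended to chains by $\Upsilon(c)=\sum_{\sigma\in c}\Upsilon(\sigma)$ (mod 2), $\Upsilon(\emptyset)=0$. The Morse reference $\Upsilon$ is the unique frame with $\Upsilon(\sigma)=\{\sigma\}$ for critical $\sigma$ and, for each regular pair $(\sigma,\tau)$, $\Upsilon(\tau)=0$ and $\Upsilon(\sigma)=\Upsilon(\partial(\tau)\setminus\{\sigma\})$. The Morse co-reference $\Upsilon^*$ is the unique frame with $\Upsilon^*(\sigma)=\{\sigma\}$ for critical $\sigma$ and, for each regular pair $(\sigma,\tau)$, $\Upsilon^*(\sigma)=0$ and $\Upsilon^*(\tau)=\Upsilon^*(\delta(\sigma)\setminus\{\tau\})$. -}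

module Defs where

open import Data.Nat using (ℕ; suc)
import Data.Nat as ℕ
open import Data.Bool using (Bool; true; false; _xor_)
import Data.Bool as B
open import Data.Fin.Subset using (Subset; _⊆_; ∣_∣; Nonempty)
open import Data.Fin.Subset.Properties using (_⊆?_)
open import Data.Vec.Properties using (≡-dec)
open import Data.List using (List; []; _∷_; filter; foldr; _++_)
open import Data.List.Membership.Propositional using () renaming (_∈_ to _∈ₗ_; _∉_ to _∉ₗ_)
open import Data.List.Relation.Unary.Unique.Propositional using (Unique)
open import Data.Product using (_×_; ∃)
open import Data.Unit using (⊤)
open import Relation.Nullary using (¬_; Dec; ¬?; ⌊_⌋)
open import Relation.Nullary.Decidable using (_×-dec_)
open import Relation.Binary.PropositionalEquality using (_≡_; _≢_)
open import Function.Bundles using (_⇔_)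

-- Vertices of a complex are labelled by Fin n; a simplex is a (non-empty)
-- subset of Fin n.  A finite simplicial complex is given by the duplicate-free
-- list of its simplexes.
Simplex : ℕ → Set
Simplex n = Subset n

_≟ₛ_ : ∀ {n} (σ τ : Simplex n) → Dec (σ ≡ τ)
_≟ₛ_ = ≡-dec B._≟_

IsDim : ∀ {n} → ℕ → Simplex n → Set
IsDim p σ = ∣ σ ∣ ≡ suc p

_⊂_ : ∀ {n} → Simplex n → Simplex n → Set
σ ⊂ τ = σ ⊆ τ × σ ≢ τ

record IsComplex {n} (K : List (Simplex n)) : Set where
  field
    unique   : Unique K
    nonempty : ∀ σ → σ ∈ₗ K → Nonempty σ
    closed   : ∀ σ τ → τ ∈ₗ K → Nonempty σ → σ ⊆ τ → σ ∈ₗ K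

Face : ∀ {n} → Simplex n → Simplex n → Set
Face ρ τ = ρ ⊆ τ × suc ∣ ρ ∣ ≡ ∣ τ ∣

face? : ∀ {n} (ρ τ : Simplex n) → Dec (Face ρ τ)
face? ρ τ = (ρ ⊆? τ) ×-dec (suc ∣ ρ ∣ ℕ.≟ ∣ τ ∣)

bd : ∀ {n} → List (Simplex n) → Simplex n → List (Simplex n)
bd K τ = filter (λ ρ → face? ρ τ) K

cobd : ∀ {n} → List (Simplex n) → Simplex n → List (Simplex n)
cobd K σ = filter (λ ρ → face? σ ρ) K

remove : ∀ {n} → Simplex n → List (Simplex n) → List (Simplex n)
remove σ c = filter (λ ρ → ¬? (ρ ≟ₛ σ)) c

data Step (n : ℕ) : Set where
  fill   : Simplex n → Step n
  expand : Simplex n → Simplex n → Step n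

added : ∀ {n} → List (Step n) → List (Simplex n)
added [] = []
added (fill σ ∷ W) = σ ∷ added W
added (expand σ τ ∷ W) = σ ∷ τ ∷ added W

IsFacetOf : ∀ {n} → Simplex n → List (Simplex n) → Set
IsFacetOf σ L = σ ∈ₗ L × (∀ ρ → ρ ∈ₗ L → ¬ (σ ⊂ ρ))

IsFreePair : ∀ {n} → Simplex n → Simplex n → List (Simplex n) → Set
IsFreePair σ τ L =
  σ ∈ₗ L × τ ∈ₗ L × Face σ τ × (∀ ρ → ρ ∈ₗ L → σ ⊂ ρ → ρ ≡ τ)

ValidFrom : ∀ {n} → List (Simplex n) → List (Step n) → Set
ValidFrom L [] = ⊤
ValidFrom L (fill σ ∷ W) =
  σ ∉ₗ L × IsComplex (σ ∷ L) × IsFacetOf σ (σ ∷ L) × ValidFrom (σ ∷ L) W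
ValidFrom L (expand σ τ ∷ W) =
  σ ∉ₗ L × τ ∉ₗ L × IsComplex (σ ∷ τ ∷ L) × IsFreePair σ τ (σ ∷ τ ∷ L)
  × ValidFrom (σ ∷ τ ∷ L) W

IsMorseSeq : ∀ {n} → List (Simplex n) → List (Step n) → Set
IsMorseSeq K W = ValidFrom [] W × (∀ σ → (σ ∈ₗ K) ⇔ (σ ∈ₗ added W))

Critical : ∀ {n} → List (Step n) → Simplex n → Set
Critical W σ = fill σ ∈ₗ W

RegularPair : ∀ {n} → List (Step n) → Simplex n → Simplex n → Set
RegularPair W σ τ = expand σ τ ∈ₗ W

-- A frame: Υ σ ρ = true  iff  ρ ∈ Υ(σ)
Frame : ℕ → Set
Frame n = Simplex n → Simplex n → Bool

-- Υ(c) = Σ_{σ ∈ c} Υ(σ)  (mod 2), evaluated at ρ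
app : ∀ {n} → Frame n → List (Simplex n) → Simplex n → Bool
app Υ c ρ = foldr (λ σ b → Υ σ ρ xor b) false c

IsFrame : ∀ {n} → List (Simplex n) → List (Step n) → Frame n → Set
IsFrame K W Υ = ∀ p σ ρ → σ ∈ₗ K → IsDim p σ → Υ σ ρ ≡ true
                  → Critical W ρ × IsDim p ρ

IsMorseReference : ∀ {n} → List (Simplex n) → List (Step n) → Frame n → Set
IsMorseReference K W Υ =
  IsFrame K W Υ
  × (∀ σ → Critical W σ → ∀ ρ → Υ σ ρ ≡ ⌊ ρ ≟ₛ σ ⌋)
  × (∀ σ τ → RegularPair W σ τ →
       (∀ ρ → Υ τ ρ ≡ false)
       × (∀ ρ → Υ σ ρ ≡ app Υ (remove σ (bd K τ)) ρ))

IsMorseCoReference : ∀ {n} → List (Simplex n) → List (Step n) → Frame n → Set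
IsMorseCoReference K W Υ* =
  IsFrame K W Υ*
  × (∀ σ → Critical W σ → ∀ ρ → Υ* σ ρ ≡ ⌊ ρ ≟ₛ σ ⌋)
  × (∀ σ τ → RegularPair W σ τ →
       (∀ ρ → Υ* σ ρ ≡ false)
       × (∀ ρ → Υ* τ ρ ≡ app Υ* (remove τ (cobd K σ)) ρ))

{-# OPTIONS --safe #-}
-- Both sides are evaluations of the double sum of Υ*(y)(τ) · Υ(x)(σ) over the
-- pairs x ⊂ y of simplexes of K with dim x + 1 = dim y, summed over y first or
-- over x first.  Summed over y, the term of y ≠ τ vanishes: Υ*(y)(τ) = 0 when
-- y is critical or the lower simplex of a regular pair, and when y is the upper
-- simplex of a regular pair (x , y) then Υ(∂y) = Υ(x) + Υ(∂y ∖ {x}) = 0.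
-- Hence the sum is Υ(∂τ)(σ); dually, summed over x it is Υ*(δσ)(τ).
module Submission where

open import Defs
open import Level using (Level)
open import Data.Nat using (ℕ; suc)
open import Data.Bool using (Bool; true; false; _xor_; _∧_)
open import Data.Bool.Properties
  using (∧-comm; ∧-zeroʳ; ∧-distribˡ-xor; xor-same; xor-identityʳ; xor-∧-commutativeRing)
open import Data.List using (List; []; _∷_; filter; foldr)
open import Data.List.Properties using (filter-all; filter-accept; filter-reject)
open import Data.List.Membership.Propositional using () renaming (_∈_ to _∈ₗ_)
open import Data.List.Membership.Propositional.Properties using (∈-filter⁺)
open import Data.List.Relation.Unary.Any using (here; there)
import Data.List.Relation.Unary.All as All
open import Data.List.Relation.Unary.AllPairs using (_∷_)
open import Data.List.Relation.Unary.Unique.Propositional using (Unique)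
open import Data.List.Relation.Unary.Unique.Propositional.Properties using (filter⁺)
open import Data.Product using (_×_; _,_; proj₁; proj₂)
import Data.Product as Product
open import Function using (_∘_)
open import Relation.Nullary using (Dec; does; ¬?; ⌊_⌋)
open import Relation.Nullary.Decidable using (isYes≗does; dec-true; dec-false)
open import Relation.Binary.PropositionalEquality
  using (_≡_; _≢_; refl; sym; trans; cong; cong₂; module ≡-Reasoning)
open import Function.Bundles using (_⇔_; mk⇔; Equivalence)
open import Algebra.Bundles using (CommutativeRing; CommutativeMonoid)
open import Algebra.Properties.CommutativeSemigroup
  (CommutativeMonoid.commutativeSemigroup (CommutativeRing.+-commutativeMonoid xor-∧-commutativeRing))
  using (interchange; x∙yz≈y∙xz)

open ≡-Reasoning

-- Sums in ℤ₂ over a list; app Υ c ρ unfolds to ∑ c (λ σ → Υ σ ρ).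
∑ : {A : Set} → List A → (A → Bool) → Bool
∑ c h = foldr (λ a s → h a xor s) false c

module _ {A : Set} where

  ∑-cong : (c : List A) {h h′ : A → Bool} → (∀ a → a ∈ₗ c → h a ≡ h′ a) → ∑ c h ≡ ∑ c h′
  ∑-cong []      eq = refl
  ∑-cong (a ∷ c) eq = cong₂ _xor_ (eq a (here refl)) (∑-cong c (λ b b∈c → eq b (there b∈c)))

  ∑-vanishing : (c : List A) {h : A → Bool} → (∀ a → a ∈ₗ c → h a ≡ false) → ∑ c h ≡ false
  ∑-vanishing []      vanish = refl
  ∑-vanishing (a ∷ c) vanish =
    cong₂ _xor_ (vanish a (here refl)) (∑-vanishing c (λ b b∈c → vanish b (there b∈c)))

  ∑-xor : (c : List A) (h h′ : A → Bool) → ∑ c (λ a → h a xor h′ a) ≡ ∑ c h xor ∑ c h′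
  ∑-xor []      h h′ = refl
  ∑-xor (a ∷ c) h h′ =
    trans (cong ((h a xor h′ a) xor_) (∑-xor c h h′)) (interchange (h a) (h′ a) _ _)

  ∧-distribˡ-∑ : (b : Bool) (c : List A) (h : A → Bool) → b ∧ ∑ c h ≡ ∑ c (λ a → b ∧ h a)
  ∧-distribˡ-∑ false c       h = sym (∑-vanishing c (λ _ _ → refl))
  ∧-distribˡ-∑ b     []      h = ∧-zeroʳ b
  ∧-distribˡ-∑ b     (a ∷ c) h =
    trans (∧-distribˡ-xor b (h a) _) (cong ((b ∧ h a) xor_) (∧-distribˡ-∑ b c h))

  ∑-filter : ∀ {ℓ} {P : A → Set ℓ} (P? : ∀ a → Dec (P a)) (c : List A) (h : A → Bool)
           → ∑ (filter P? c) h ≡ ∑ c (λ a → does (P? a) ∧ h a)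
  ∑-filter P? []      h = refl
  ∑-filter P? (a ∷ c) h with does (P? a)
  ... | true  = cong (h a xor_) (∑-filter P? c h)
  ... | false = ∑-filter P? c h

  ∑-single : {c : List A} {x : A} (h : A → Bool) → Unique c → x ∈ₗ c
           → (∀ a → a ∈ₗ c → a ≢ x → h a ≡ false) → ∑ c h ≡ h x
  ∑-single {a ∷ c} h (a∉c ∷ _) (here refl) vanish = begin
    h a xor ∑ c h  ≡⟨ cong (h a xor_) (∑-vanishing c rest-vanishes) ⟩
    h a xor false  ≡⟨ xor-identityʳ (h a) ⟩
    h a            ∎
    where
    rest-vanishes : ∀ b → b ∈ₗ c → h b ≡ false
    rest-vanishes b b∈c = vanish b (there b∈c) (λ b≡a → All.lookup a∉c b∈c (sym b≡a))
  ∑-single {a ∷ c} h (a∉c ∷ c-unique) (there x∈c) vanish =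
    cong₂ _xor_ (vanish a (here refl) (All.lookup a∉c x∈c))
                (∑-single h c-unique x∈c (λ b b∈c → vanish b (there b∈c)))

∑-comm : {A B : Set} (c : List A) (d : List B) (k : A → B → Bool)
       → ∑ c (λ a → ∑ d (k a)) ≡ ∑ d (λ b → ∑ c (λ a → k a b))
∑-comm []      d k = sym (∑-vanishing d (λ _ _ → refl))
∑-comm (a ∷ c) d k = trans (cong (∑ d (k a) xor_) (∑-comm c d k)) (sym (∑-xor d (k a) _))

∑-transpose : {A : Set} {ℓ : Level} {R : A → A → Set ℓ} (R? : ∀ x y → Dec (R x y))
              (c : List A) (f g : A → Bool)
            → ∑ c (λ y → g y ∧ ∑ (filter (λ x → R? x y) c) f)
            ≡ ∑ c (λ x → f x ∧ ∑ (filter (λ y → R? x y) c) g)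
∑-transpose R? c f g = begin
  ∑ c (λ y → g y ∧ ∑ (filter (λ x → R? x y) c) f)
    ≡⟨ ∑-cong c (λ y _ → expand-row y) ⟩
  ∑ c (λ y → ∑ c (λ x → g y ∧ (does (R? x y) ∧ f x)))
    ≡⟨ ∑-comm c c (λ y x → g y ∧ (does (R? x y) ∧ f x)) ⟩
  ∑ c (λ x → ∑ c (λ y → g y ∧ (does (R? x y) ∧ f x)))
    ≡⟨ ∑-cong c (λ x _ → ∑-cong c (λ y _ → swap-factors x y)) ⟩
  ∑ c (λ x → ∑ c (λ y → f x ∧ (does (R? x y) ∧ g y)))
    ≡⟨ ∑-cong c (λ x _ → sym (expand-column x)) ⟩
  ∑ c (λ x → f x ∧ ∑ (filter (λ y → R? x y) c) g)
    ∎
  where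
  expand-row : ∀ y → g y ∧ ∑ (filter (λ x → R? x y) c) f
                   ≡ ∑ c (λ x → g y ∧ (does (R? x y) ∧ f x))
  expand-row y = trans (cong (g y ∧_) (∑-filter (λ x → R? x y) c f)) (∧-distribˡ-∑ (g y) c _)

  expand-column : ∀ x → f x ∧ ∑ (filter (λ y → R? x y) c) g
                      ≡ ∑ c (λ y → f x ∧ (does (R? x y) ∧ g y))
  expand-column x = trans (cong (f x ∧_) (∑-filter (R? x) c g)) (∧-distribˡ-∑ (f x) c _)

  swap-factors : ∀ x y → g y ∧ (does (R? x y) ∧ f x) ≡ f x ∧ (does (R? x y) ∧ g y)
  swap-factors x y with does (R? x y)
  ... | true  = ∧-comm (g y) (f x)
  ... | false = trans (∧-zeroʳ (g y)) (sym (∧-zeroʳ (f x)))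

module _ {n : ℕ} where

  ∑-remove : {c : List (Simplex n)} {x : Simplex n} (h : Simplex n → Bool)
           → Unique c → x ∈ₗ c → ∑ c h ≡ h x xor ∑ (remove x c) h
  ∑-remove {a ∷ c} h (a∉c ∷ _) (here refl) = cong (λ c′ → h a xor ∑ c′ h) (sym remove-head)
    where
    remove-head : remove a (a ∷ c) ≡ c
    remove-head = trans (filter-reject (λ ρ → ¬? (ρ ≟ₛ a)) (λ a≢a → a≢a refl))
                        (filter-all (λ ρ → ¬? (ρ ≟ₛ a)) (All.map (λ a≢b b≡a → a≢b (sym b≡a)) a∉c))
  ∑-remove {a ∷ c} {x} h (a∉c ∷ c-unique) (there x∈c) = begin
    h a xor ∑ c h                       ≡⟨ cong (h a xor_) (∑-remove h c-unique x∈c) ⟩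
    h a xor (h x xor ∑ (remove x c) h)  ≡⟨ x∙yz≈y∙xz (h a) (h x) (∑ (remove x c) h) ⟩
    h x xor (h a xor ∑ (remove x c) h)  ≡⟨ cong (λ c′ → h x xor ∑ c′ h) (sym remove-cons) ⟩
    h x xor ∑ (remove x (a ∷ c)) h      ∎
    where
    remove-cons : remove x (a ∷ c) ≡ a ∷ remove x c
    remove-cons = filter-accept (λ ρ → ¬? (ρ ≟ₛ x)) (All.lookup a∉c x∈c)

  ∑-cancel-remove : {c : List (Simplex n)} {x : Simplex n} (h : Simplex n → Bool)
                  → Unique c → x ∈ₗ c → h x ≡ ∑ (remove x c) h → ∑ c h ≡ false
  ∑-cancel-remove {x = x} h c-unique x∈c hx≡rest =
    trans (∑-remove h c-unique x∈c) (trans (cong (h x xor_) (sym hx≡rest)) (xor-same (h x)))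

  data Role (W : List (Step n)) (y : Simplex n) : Set where
    critical : Critical W y → Role W y
    lower    : ∀ {z} → RegularPair W y z → Role W y
    upper    : ∀ {x} → RegularPair W x y → Role W y

  role-∷ : ∀ {s W y} → Role W y → Role (s ∷ W) y
  role-∷ (critical y-crit) = critical (there y-crit)
  role-∷ (lower yz)        = lower (there yz)
  role-∷ (upper xy)        = upper (there xy)

  role : (W : List (Step n)) {y : Simplex n} → y ∈ₗ added W → Role W y
  role (fill σ ∷ W)     (here refl)         = critical (here refl)
  role (fill σ ∷ W)     (there y∈W)         = role-∷ (role W y∈W)
  role (expand σ τ ∷ W) (here refl)         = lower (here refl)
  role (expand σ τ ∷ W) (there (here refl)) = upper (here refl)
  role (expand σ τ ∷ W) (there (there y∈W)) = role-∷ (role W y∈W)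

  regularPair-face : {L : List (Simplex n)} {W : List (Step n)} {x y : Simplex n}
                   → ValidFrom L W → RegularPair W x y → Face x y
  regularPair-face {W = fill σ ∷ W}     (_ , _ , _ , valid)                 (there xy)  =
    regularPair-face valid xy
  regularPair-face {W = expand σ τ ∷ W} (_ , _ , _ , (_ , _ , στ , _) , _) (here refl) = στ
  regularPair-face {W = expand σ τ ∷ W} (_ , _ , _ , _ , valid)             (there xy)  =
    regularPair-face valid xy

  regularPair-added : (W : List (Step n)) {x y : Simplex n}
                    → RegularPair W x y → x ∈ₗ added W × y ∈ₗ added W
  regularPair-added (fill σ ∷ W)     (there xy)  = Product.map there there (regularPair-added W xy)
  regularPair-added (expand σ τ ∷ W) (here refl) = here refl , there (here refl)
  regularPair-added (expand σ τ ∷ W) (there xy)  =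
    Product.map (there ∘ there) (there ∘ there) (regularPair-added W xy)

  IdentityOnCritical : List (Step n) → Frame n → Set
  IdentityOnCritical W Υ = ∀ σ → Critical W σ → ∀ ρ → Υ σ ρ ≡ ⌊ ρ ≟ₛ σ ⌋

  critical-off-diagonal : ∀ {W} {Υ : Frame n} → IdentityOnCritical W Υ
                        → ∀ {y ρ} → Critical W y → y ≢ ρ → Υ y ρ ≡ false
  critical-off-diagonal {Υ = Υ} identity {y} {ρ} y-crit y≢ρ = begin
    Υ y ρ             ≡⟨ identity y y-crit ρ ⟩
    ⌊ ρ ≟ₛ y ⌋        ≡⟨ isYes≗does (ρ ≟ₛ y) ⟩
    does (ρ ≟ₛ y)     ≡⟨ dec-false (ρ ≟ₛ y) (λ ρ≡y → y≢ρ (sym ρ≡y)) ⟩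
    false             ∎

  critical-diagonal : ∀ {W} {Υ : Frame n} → IdentityOnCritical W Υ
                    → ∀ {y} → Critical W y → Υ y y ≡ true
  critical-diagonal {Υ = Υ} identity {y} y-crit = begin
    Υ y y             ≡⟨ identity y y-crit y ⟩
    ⌊ y ≟ₛ y ⌋        ≡⟨ isYes≗does (y ≟ₛ y) ⟩
    does (y ≟ₛ y)     ≡⟨ dec-true (y ≟ₛ y) refl ⟩
    true              ∎

module MorseFrames {n : ℕ} {K : List (Simplex n)} {W : List (Step n)}
                   (K-complex : IsComplex K) (W-morse : IsMorseSeq K W) where

  K-unique : Unique K
  K-unique = IsComplex.unique K-complex

  added⇒∈K : ∀ {y} → y ∈ₗ added W → y ∈ₗ K
  added⇒∈K {y} = Equivalence.from (proj₂ W-morse y)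

  role-in-K : ∀ {y} → y ∈ₗ K → Role W y
  role-in-K {y} y∈K = role W (Equivalence.to (proj₂ W-morse y) y∈K)

  bd-upper-vanishes : ∀ {Υ} → IsMorseReference K W Υ
                    → ∀ {x y} → RegularPair W x y → ∀ ρ → app Υ (bd K y) ρ ≡ false
  bd-upper-vanishes {Υ} (_ , _ , regular) {x} {y} xy ρ =
    ∑-cancel-remove (λ π → Υ π ρ) (filter⁺ _ K-unique) x∈∂y (proj₂ (regular x y xy) ρ)
    where
    x∈∂y : x ∈ₗ bd K y
    x∈∂y = ∈-filter⁺ (λ π → face? π y) (added⇒∈K (proj₁ (regularPair-added W xy)))
                     (regularPair-face (proj₁ W-morse) xy)

  cobd-lower-vanishes : ∀ {Υ*} → IsMorseCoReference K W Υ*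
                      → ∀ {x y} → RegularPair W x y → ∀ ρ → app Υ* (cobd K x) ρ ≡ false
  cobd-lower-vanishes {Υ*} (_ , _ , regular) {x} {y} xy ρ =
    ∑-cancel-remove (λ π → Υ* π ρ) (filter⁺ _ K-unique) y∈δx (proj₂ (regular x y xy) ρ)
    where
    y∈δx : y ∈ₗ cobd K x
    y∈δx = ∈-filter⁺ (λ π → face? x π) (added⇒∈K (proj₂ (regularPair-added W xy)))
                     (regularPair-face (proj₁ W-morse) xy)

  module _ {Υ Υ* : Frame n} (Υ-ref : IsMorseReference K W Υ)
           (Υ*-coref : IsMorseCoReference K W Υ*) {σ τ : Simplex n} where

    row-vanishes : ∀ y → y ∈ₗ K → y ≢ τ → Υ* y τ ∧ app Υ (bd K y) σ ≡ false
    row-vanishes y y∈K y≢τ with role-in-K y∈K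
    ... | critical y-crit =
      cong (_∧ _) (critical-off-diagonal (proj₁ (proj₂ Υ*-coref)) y-crit y≢τ)
    ... | lower yz        = cong (_∧ _) (proj₁ (proj₂ (proj₂ Υ*-coref) y _ yz) τ)
    ... | upper xy        = trans (cong (Υ* y τ ∧_) (bd-upper-vanishes Υ-ref xy σ)) (∧-zeroʳ _)

    column-vanishes : ∀ x → x ∈ₗ K → x ≢ σ → Υ x σ ∧ app Υ* (cobd K x) τ ≡ false
    column-vanishes x x∈K x≢σ with role-in-K x∈K
    ... | critical x-crit =
      cong (_∧ _) (critical-off-diagonal (proj₁ (proj₂ Υ-ref)) x-crit x≢σ)
    ... | upper wx        = cong (_∧ _) (proj₁ (proj₂ (proj₂ Υ-ref) _ x wx) σ)
    ... | lower xz        = trans (cong (Υ x σ ∧_) (cobd-lower-vanishes Υ*-coref xz τ)) (∧-zeroʳ _)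

    row-sum : τ ∈ₗ K → Critical W τ
            → ∑ K (λ y → Υ* y τ ∧ app Υ (bd K y) σ) ≡ app Υ (bd K τ) σ
    row-sum τ∈K τ-crit = trans (∑-single _ K-unique τ∈K row-vanishes)
                               (cong (_∧ _) (critical-diagonal (proj₁ (proj₂ Υ*-coref)) τ-crit))

    column-sum : σ ∈ₗ K → Critical W σ
               → ∑ K (λ x → Υ x σ ∧ app Υ* (cobd K x) τ) ≡ app Υ* (cobd K σ) τ
    column-sum σ∈K σ-crit = trans (∑-single _ K-unique σ∈K column-vanishes)
                                  (cong (_∧ _) (critical-diagonal (proj₁ (proj₂ Υ-ref)) σ-crit))

theorem1 : (n : ℕ) (K : List (Simplex n)) (W : List (Step n))
    → IsComplex K → IsMorseSeq K W
    → (Υ Υ* : Frame n)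
    → IsMorseReference K W Υ → IsMorseCoReference K W Υ*
    → (p : ℕ) (σ τ : Simplex n)
    → σ ∈ₗ K → τ ∈ₗ K → IsDim p σ → IsDim (suc p) τ
    → Critical W σ → Critical W τ
    → (app Υ (bd K τ) σ ≡ true) ⇔ (app Υ* (cobd K σ) τ ≡ true)
theorem1 n K W K-complex W-morse Υ Υ* Υ-ref Υ*-coref _ σ τ σ∈K τ∈K _ _ σ-crit τ-crit =
  mk⇔ (trans (sym bd≡cobd)) (trans bd≡cobd)
  where
  open MorseFrames K-complex W-morse

  bd≡cobd : app Υ (bd K τ) σ ≡ app Υ* (cobd K σ) τ
  bd≡cobd = begin
    app Υ (bd K τ) σ                          ≡⟨ sym (row-sum Υ-ref Υ*-coref τ∈K τ-crit) ⟩
    ∑ K (λ y → Υ* y τ ∧ app Υ (bd K y) σ)     ≡⟨ ∑-transpose face? K (λ x → Υ x σ) (λ y → Υ* y τ) ⟩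
    ∑ K (λ x → Υ x σ ∧ app Υ* (cobd K x) τ)   ≡⟨ column-sum Υ-ref Υ*-coref σ∈K σ-crit ⟩
    app Υ* (cobd K σ) τ                       ∎
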